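{- Let $\alpha=\alpha_1\cdots\alpha_n$ and $\beta=\beta_1\cdots\beta_n$ be two words of positive integers on which the SR algorithm does not terminate. If $s_{\alpha_1}s_{\alpha_2}\cdots s_{\alpha_n}=s_{\beta_1}s_{\beta_2}\cdots s_{\beta_n}$ as permutations, then $\mathrm{shape}(R(\alpha))=\mathrm{shape}(R(\beta))$.
   Context: $s_i$ denotes the adjacent transposition $(i,i+1)$ of the positive integers. A cell is a pair $(i,j)$ of integers with $i\ge 1$, $j\ge 0$. A tower diagram is a finite set $\mathcal T$ of cells such that $(i,j)\in\mathcal T$ and $0\le k\le j$ imply $(i,k)\in\mathcal T$. The cell $(i,j)$ lies on the diagonal $x+y=i+j$. Sliding: for a positive integer $\alpha$, $\alpha^{\searrow}\mathcal T$ is computed by the procedure $P(\gamma,m)$ started at $\gamma=\alpha$, $m=1$: (S1) if no cell $(i,j)\in\mathcal T$ with $i\ge m$ lies on $x+y=\gamma-1$: (a) if $(\gamma,0)\notin\mathcal T$ the result is $\mathcal T\cup\{(\gamma,0)\}$; (b) if $(\gamma,0)\in\mathcal T$, $(\gamma,1)\notin\mathcal T$ the slide terminates (without result); (c) if $(\gamma,0),(\gamma,1)\in\mathcal T$, continue with $P(\gamma+1,\gamma+1)$. (S2) Otherwise let $i\ge m$ be smallest with $(i,\gamma-1-i)\in\mathcal T$: (a) if $(i,\gamma-i)\notin\mathcal T$ the result is $\mathcal T\cup\{(i,\gamma-i)\}$; (b) if $(i,\gamma-i)\in\mathcal T$, $(i,\gamma-i+1)\notin\mathcal T$ the slide terminates;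 (c) if both are in $\mathcal T$, continue with $P(\gamma+1,i+1)$. SR algorithm: for a word $\alpha=\alpha_1\cdots\alpha_n$, set $\mathcal T^{(0)}=\varnothing$, $\mathcal T^{(k)}=\alpha_k^{\searrow}\mathcal T^{(k-1)}$; if some slide terminates, the algorithm terminates. Otherwise $\mathcal T^{(k)}=\mathcal T^{(k-1)}\cup\{d_k\}$, the recording tableau $R(\alpha)$ labels $d_k$ by $k$, and $\mathrm{shape}(R(\alpha))=\mathcal T^{(n)}$. -}

module Defs where

open import Data.Nat using (ℕ; zero; suc; _+_; _≤_; _<_; _≟_)
open import Data.Product using (_×_; _,_)
open import Data.List using (List; []; _∷_)
open import Data.List.Membership.Propositional using (_∈_; _∉_)
open import Relation.Binary.PropositionalEquality using (_≡_)
open import Relation.Nullary using (¬_; yes; no)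
open import Function using (id; _∘_)

-- A cell (i , j); a tower diagram is represented by a finite list of cells,
-- read as a finite set (membership _∈_).
Cell : Set
Cell = ℕ × ℕ

Diagram : Set
Diagram = List Cell

NoDiag : Diagram → ℕ → ℕ → Set
NoDiag T γ m = ∀ i j → m ≤ i → i + j + 1 ≡ γ → (i , j) ∉ T

FirstOnDiag : Diagram → ℕ → ℕ → ℕ → ℕ → Set
FirstOnDiag T γ m i j =
  (m ≤ i) × (i + j + 1 ≡ γ) × ((i , j) ∈ T) ×
  (∀ i' j' → m ≤ i' → i' < i → i' + j' + 1 ≡ γ → (i' , j') ∉ T)

-- Slide T γ m R : the procedure P(γ,m) on T succeeds with result R.
-- (Terminating cases (b) simply produce no result.)
data Slide (T : Diagram) : ℕ → ℕ → Diagram → Set where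
  s1a : ∀ {γ m} → NoDiag T γ m → (γ , 0) ∉ T →
        Slide T γ m ((γ , 0) ∷ T)
  s1c : ∀ {γ m R} → NoDiag T γ m → (γ , 0) ∈ T → (γ , 1) ∈ T →
        Slide T (suc γ) (suc γ) R → Slide T γ m R
  s2a : ∀ {γ m i j} → FirstOnDiag T γ m i j → (i , suc j) ∉ T →
        Slide T γ m ((i , suc j) ∷ T)
  s2c : ∀ {γ m i j R} → FirstOnDiag T γ m i j →
        (i , suc j) ∈ T → (i , suc (suc j)) ∈ T →
        Slide T (suc γ) (suc i) R → Slide T γ m R

SlideInto : ℕ → Diagram → Diagram → Set
SlideInto α T R = Slide T α 1 R

data Run : Diagram → List ℕ → Diagram → Set where
  done : ∀ {T} → Run T [] T
  step : ∀ {T T' R a w} → SlideInto a T T' → Run T' w R → Run T (a ∷ w) R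

SRShape : List ℕ → Diagram → Set
SRShape α S = Run [] α S

_≈D_ : Diagram → Diagram → Set
T ≈D T' = ∀ c → (c ∈ T → c ∈ T') × (c ∈ T' → c ∈ T)

s : ℕ → ℕ → ℕ
s i x with x ≟ i
... | yes _ = suc i
... | no _ with x ≟ suc i
...   | yes _ = i
...   | no _ = x

sprod : List ℕ → ℕ → ℕ
sprod [] = id
sprod (a ∷ w) = s a ∘ sprod w

-- After inserting the letters a₁ ⋯ a_k, the diagram has towers of heights
-- c i = #{q > i ∣ v q < v i}, the Lehmer code of v = s_{a_k} ∘ ⋯ ∘ s_{a₁}.
-- Sliding a further letter a adds exactly the cell (p , c p) with v p = a, and
-- succeeds only if a + 1 sits to the right of a in v; this is how the code
-- changes from v to s_a ∘ v. The walk along the diagonals is controlled by the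
-- balance i + c i = v i + #{q < i ∣ v q > v i}: positions with v i < a lie below
-- the current diagonal, p lies on it, and positions with v i > a lie above it.
-- So the shape only depends on v, which is the inverse of s_{a₁} ∘ ⋯ ∘ s_{a_k}.

module Submission where

open import Defs
open import Data.Empty using (⊥-elim)
open import Data.List using (List; []; _∷_; length)
open import Data.List.Membership.Propositional using (_∈_; _∉_)
open import Data.List.Relation.Unary.All using (All; []; _∷_)
open import Data.List.Relation.Unary.Any using (here; there)
open import Data.Nat using (ℕ; zero; suc; _+_; _≤_; _<_; _≟_; _<?_; z≤n; s≤s; z<s)
open import Data.Nat.ListAction using (sum)
open import Data.Nat.Properties
open import Algebra.Properties.CommutativeSemigroup +-commutativeSemigroup using (x∙yz≈xz∙y; xy∙z≈xz∙y)
open import Data.Product using (_×_; _,_; proj₁; proj₂; swap)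
open import Data.Sum using (inj₁; inj₂; [_,_]′)
open import Data.Unit using (⊤; tt)
open import Function using (_⇔_; mk⇔; Equivalence; _∘_; id)
open import Function.Properties.Equivalence using () renaming (sym to ⇔-sym)
open import Level using (0ℓ)
open import Relation.Binary using (tri<; tri≈; tri>)
open import Relation.Binary.PropositionalEquality
open import Relation.Nullary using (¬_; yes; no)
open import Relation.Unary using (Pred; Decidable)
open import Relation.Unary.Properties using (_∩?_; ∁?; U?)

private variable
  P Q : Pred ℕ 0ℓ

×-⇔ʳ : ∀ {A B C : Set} → (A → B ⇔ C) → (A × B) ⇔ (A × C)
×-⇔ʳ B⇔C = mk⇔ (λ (x , y) → x , Equivalence.to (B⇔C x) y) (λ (x , z) → x , Equivalence.from (B⇔C x) z)

count : Decidable P → ℕ → ℕ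
count P? zero = 0
count P? (suc n) with P? n
... | yes _ = suc (count P? n)
... | no  _ = count P? n

below : ∀ {n} {X : ℕ → Set} → (∀ q → q < suc n → X q) → ∀ q → q < n → X q
below h q q<n = h q (m<n⇒m<1+n q<n)

count-mono : {P? : Decidable P} {Q? : Decidable Q} →
             ∀ n → (∀ q → q < n → P q → Q q) → count P? n ≤ count Q? n
count-mono zero    _   = z≤n
count-mono {P? = P?} {Q? = Q?} (suc n) P⇒Q with P? n | Q? n
... | yes _  | yes _  = s≤s (count-mono n (below P⇒Q))
... | yes Pn | no ¬Qn = ⊥-elim (¬Qn (P⇒Q n ≤-refl Pn))
... | no  _  | yes _  = m≤n⇒m≤1+n (count-mono n (below P⇒Q))
... | no  _  | no  _  = count-mono n (below P⇒Q)

count-cong : {P? : Decidable P} {Q? : Decidable Q} →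
             ∀ n → (∀ q → q < n → P q ⇔ Q q) → count P? n ≡ count Q? n
count-cong n P⇔Q = ≤-antisym (count-mono n (λ q q<n → Equivalence.to (P⇔Q q q<n)))
                             (count-mono n (λ q q<n → Equivalence.from (P⇔Q q q<n)))

count-insert : {P? : Decidable P} {Q? : Decidable Q} → ∀ n q₀ → q₀ < n → ¬ P q₀ → Q q₀ →
               (∀ q → q < n → q ≢ q₀ → P q ⇔ Q q) → count Q? n ≡ suc (count P? n)
count-insert {P? = P?} {Q? = Q?} (suc n) q₀ q₀<1+n ¬Pq₀ Qq₀ P⇔Q with q₀ ≟ n | P? n | Q? n
... | yes refl | yes Pq₀ | _      = ⊥-elim (¬Pq₀ Pq₀)
... | yes refl | no _    | no ¬Qq₀ = ⊥-elim (¬Qq₀ Qq₀)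
... | yes refl | no _    | yes _  = cong suc (sym (count-cong q₀ λ q q<q₀ → below P⇔Q q q<q₀ (<⇒≢ q<q₀)))
... | no q₀≢n  | yes _   | yes _  =
  cong suc (count-insert n q₀ (≤∧≢⇒< (≤-pred q₀<1+n) q₀≢n) ¬Pq₀ Qq₀ (below P⇔Q))
... | no q₀≢n  | no _    | no _   =
  count-insert n q₀ (≤∧≢⇒< (≤-pred q₀<1+n) q₀≢n) ¬Pq₀ Qq₀ (below P⇔Q)
... | no q₀≢n  | yes Pn  | no ¬Qn = ⊥-elim (¬Qn (Equivalence.to (P⇔Q n ≤-refl (≢-sym q₀≢n)) Pn))
... | no q₀≢n  | no ¬Pn  | yes Qn = ⊥-elim (¬Pn (Equivalence.from (P⇔Q n ≤-refl (≢-sym q₀≢n)) Qn))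

count-split : (P? : Decidable P) (Q? : Decidable Q) →
              ∀ n → count P? n ≡ count (P? ∩? Q?) n + count (P? ∩? ∁? Q?) n
count-split P? Q? zero = refl
count-split P? Q? (suc n) with P? n | Q? n
... | yes _ | yes _ = cong suc (count-split P? Q? n)
... | yes _ | no  _ = trans (cong suc (count-split P? Q? n)) (sym (+-suc _ _))
... | no  _ | yes _ = count-split P? Q? n
... | no  _ | no  _ = count-split P? Q? n

count-mono-bound : ∀ {m n} {P? : Decidable P} → m ≤ n → count P? m ≤ count P? n
count-mono-bound {n = zero} z≤n = z≤n
count-mono-bound {n = suc n} {P? = P?} m≤1+n with m≤n⇒m<n∨m≡n m≤1+n
... | inj₂ refl  = ≤-refl
... | inj₁ m<1+n with P? n
...   | yes _ = m≤n⇒m≤1+n (count-mono-bound (≤-pred m<1+n))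
...   | no  _ = count-mono-bound (≤-pred m<1+n)

count-stable : ∀ {m n} {P? : Decidable P} →
               m ≤ n → (∀ q → m ≤ q → q < n → ¬ P q) → count P? n ≡ count P? m
count-stable {n = zero} z≤n _ = refl
count-stable {n = suc n} {P? = P?} m≤1+n ¬P with m≤n⇒m<n∨m≡n m≤1+n
... | inj₂ refl  = refl
... | inj₁ m<1+n with P? n
...   | yes Pn = ⊥-elim (¬P n (≤-pred m<1+n) ≤-refl Pn)
...   | no  _  = count-stable (≤-pred m<1+n) (λ q m≤q q<n → ¬P q m≤q (m<n⇒m<1+n q<n))

count-U : ∀ n → count U? n ≡ n
count-U zero    = refl
count-U (suc n) = cong suc (count-U n)

count-prefix : ∀ {k n} (P? : Decidable P) → k ≤ n → count ((_<? k) ∩? P?) n ≡ count P? k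
count-prefix {n = zero} P? z≤n = refl
count-prefix {k = k} {n = suc n} P? k≤1+n with m≤n⇒m<n∨m≡n k≤1+n
... | inj₁ k<1+n with n <? k
...   | yes n<k = ⊥-elim (<⇒≱ n<k (≤-pred k<1+n))
...   | no  _   = count-prefix P? (≤-pred k<1+n)
count-prefix {k = k} {n = suc n} P? k≤1+n | inj₂ refl with n <? suc n | P? n
...   | no n≮1+n | _     = ⊥-elim (n≮1+n ≤-refl)
...   | yes _    | yes _ = cong suc (count-cong n λ q q<n → mk⇔ proj₂ (m<n⇒m<1+n q<n ,_))
...   | yes _    | no  _ = count-cong n λ q q<n → mk⇔ proj₂ (m<n⇒m<1+n q<n ,_)

count-split-⊆ : {P? : Decidable P} {Q? : Decidable Q} → ∀ n → (∀ q → P q → Q q) →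
                count Q? n ≡ count P? n + count (Q? ∩? ∁? P?) n
count-split-⊆ {P? = P?} {Q? = Q?} n P⊆Q = trans (count-split Q? P? n)
  (cong (_+ count (Q? ∩? ∁? P?) n) (count-cong n λ q _ → mk⇔ proj₂ (λ Pq → P⊆Q q Pq , Pq)))

count-suc : {P? : Decidable P} → ∀ n → P n → count P? (suc n) ≡ suc (count P? n)
count-suc {P? = P?} n Pn with P? n
... | yes _  = refl
... | no ¬Pn = ⊥-elim (¬Pn Pn)

data SwapView (a : ℕ) : ℕ → Set where
  at-a   : SwapView a a
  at-1+a : SwapView a (suc a)
  other  : ∀ {x} → x ≢ a → x ≢ suc a → SwapView a x

swapView : ∀ a x → SwapView a x
swapView a x with x ≟ a | x ≟ suc a
... | yes refl | _        = at-a
... | no _     | yes refl = at-1+a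
... | no x≢a   | no x≢1+a = other x≢a x≢1+a

s-a : ∀ a → s a a ≡ suc a
s-a a with a ≟ a
... | yes _  = refl
... | no a≢a = ⊥-elim (a≢a refl)

s-1+a : ∀ a → s a (suc a) ≡ a
s-1+a a with suc a ≟ a
... | yes 1+a≡a = ⊥-elim (1+n≢n 1+a≡a)
... | no _ with suc a ≟ suc a
...   | yes _      = refl
...   | no 1+a≢1+a = ⊥-elim (1+a≢1+a refl)

s-other : ∀ a {x} → x ≢ a → x ≢ suc a → s a x ≡ x
s-other a {x} x≢a x≢1+a with x ≟ a
... | yes x≡a = ⊥-elim (x≢a x≡a)
... | no _ with x ≟ suc a
...   | yes x≡1+a = ⊥-elim (x≢1+a x≡1+a)
...   | no _      = refl

s-involutive : ∀ a x → s a (s a x) ≡ x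
s-involutive a x with swapView a x
... | at-a   rewrite s-a a   = s-1+a a
... | at-1+a rewrite s-1+a a = s-a a
... | other x≢a x≢1+a rewrite s-other a x≢a x≢1+a = s-other a x≢a x≢1+a

s-injective : ∀ a {x y} → s a x ≡ s a y → x ≡ y
s-injective a {x} {y} e = trans (sym (s-involutive a x)) (trans (cong (s a) e) (s-involutive a y))

s-mono-< : ∀ a {x y} → ¬ (x ≡ a × y ≡ suc a) → x < y → s a x < s a y
s-mono-< a {x} {y} ¬swapped x<y with swapView a x | swapView a y
... | at-a   | at-a   = ⊥-elim (<-irrefl refl x<y)
... | at-a   | at-1+a = ⊥-elim (¬swapped (refl , refl))
... | at-a   | other y≢a y≢1+a
      rewrite s-a a | s-other a y≢a y≢1+a = ≤∧≢⇒< x<y (y≢1+a ∘ sym)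
... | at-1+a | at-a   = ⊥-elim (<-asym x<y (n<1+n a))
... | at-1+a | at-1+a = ⊥-elim (<-irrefl refl x<y)
... | at-1+a | other y≢a y≢1+a
      rewrite s-1+a a | s-other a y≢a y≢1+a = <-trans (n<1+n a) x<y
... | other x≢a x≢1+a | at-a
      rewrite s-a a | s-other a x≢a x≢1+a = m<n⇒m<1+n x<y
... | other x≢a x≢1+a | at-1+a
      rewrite s-1+a a | s-other a x≢a x≢1+a = ≤∧≢⇒< (≤-pred x<y) x≢a
... | other x≢a x≢1+a | other y≢a y≢1+a
      rewrite s-other a x≢a x≢1+a | s-other a y≢a y≢1+a = x<y

s-<-⇔ : ∀ a {x y} → ¬ (x ≡ a × y ≡ suc a) → ¬ (x ≡ suc a × y ≡ a) → s a x < s a y ⇔ x < y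
s-<-⇔ a {x} {y} ¬ab ¬ba = mk⇔ from-swapped (s-mono-< a ¬ab)
  where
  from-swapped : s a x < s a y → x < y
  from-swapped sx<sy = subst₂ _<_ (s-involutive a x) (s-involutive a y) (s-mono-< a ¬ba′ sx<sy)
    where
    ¬ba′ : ¬ (s a x ≡ a × s a y ≡ suc a)
    ¬ba′ (sx≡a , sy≡1+a) = ¬ba ( s-injective a (trans sx≡a (sym (s-1+a a)))
                               , s-injective a (trans sy≡1+a (sym (s-a a))))

s-<-bound-⇔ : ∀ a x {k} → k ≢ suc a → s a x < k ⇔ x < k
s-<-bound-⇔ a x {k} k≢1+a with swapView a x
... | at-a   rewrite s-a a   = mk⇔ (<-trans (n<1+n a)) (λ a<k → ≤∧≢⇒< a<k (k≢1+a ∘ sym))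
... | at-1+a rewrite s-1+a a = mk⇔ (λ a<k → ≤∧≢⇒< a<k (k≢1+a ∘ sym)) (<-trans (n<1+n a))
... | other x≢a x≢1+a rewrite s-other a x≢a x≢1+a = mk⇔ id id

rightInversions : ℕ → (ℕ → ℕ) → ℕ → ℕ
rightInversions N v i = count ((i <?_) ∩? (λ q → v q <? v i)) N

leftInversions : (ℕ → ℕ) → ℕ → ℕ
leftInversions v i = count (λ q → v i <? v q) i

-- v permutes [0, N) and fixes 0, the position left free by the convention i ≥ 1 on cells;
-- count-below records surjectivity in the counting form in which it is used.
record IsPerm (N : ℕ) (v v⁻¹ : ℕ → ℕ) : Set where
  field
    inverseˡ    : ∀ x → v⁻¹ (v x) ≡ x
    inverseʳ    : ∀ x → v (v⁻¹ x) ≡ x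
    fixes-≥     : ∀ x → N ≤ x → v x ≡ x
    fixes-0     : v 0 ≡ 0
    count-below : ∀ k → k ≤ N → count (λ q → v q <? k) N ≡ k

  v⁻¹-unique : ∀ {x y} → v x ≡ y → x ≡ v⁻¹ y
  v⁻¹-unique {x} vx≡y = trans (sym (inverseˡ x)) (cong v⁻¹ vx≡y)

  injective : ∀ {x y} → v x ≡ v y → x ≡ y
  injective {x} {y} vx≡vy = trans (v⁻¹-unique vx≡vy) (inverseˡ y)

  fixes-≥⁻¹ : ∀ {x} → N ≤ x → v⁻¹ x ≡ x
  fixes-≥⁻¹ {x} N≤x = trans (cong v⁻¹ (sym (fixes-≥ x N≤x))) (inverseˡ x)

  <-bound : ∀ {x} → x < N → v x < N
  <-bound {x} x<N with N ≤? v x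
  ... | no  N≰vx = ≰⇒> N≰vx
  ... | yes N≤vx = ⊥-elim (<⇒≱ x<N (subst (N ≤_) (trans (sym (fixes-≥⁻¹ N≤vx)) (inverseˡ x)) N≤vx))

  <-bound⁻¹ : ∀ {x} → x < N → v⁻¹ x < N
  <-bound⁻¹ {x} x<N with N ≤? v⁻¹ x
  ... | no  N≰v⁻¹x = ≰⇒> N≰v⁻¹x
  ... | yes N≤v⁻¹x = ⊥-elim (<⇒≱ x<N (subst (N ≤_) (trans (sym (fixes-≥ _ N≤v⁻¹x)) (inverseʳ x)) N≤v⁻¹x))

  count-between : ∀ {x y} → x < y → y ≤ N →
                  y ≡ suc x + count ((λ q → x <? v q) ∩? (λ q → v q <? y)) N
  count-between {x} {y} x<y y≤N = begin
      y
    ≡⟨ count-below y y≤N ⟨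
      count (λ q → v q <? y) N
    ≡⟨ count-split-⊆ N (λ q vq<1+x → <-≤-trans vq<1+x x<y) ⟩
      count (λ q → v q <? suc x) N + count ((λ q → v q <? y) ∩? ∁? (λ q → v q <? suc x)) N
    ≡⟨ cong₂ _+_ (count-below (suc x) (≤-trans x<y y≤N)) (count-cong N λ _ _ → between) ⟩
      suc x + count ((λ q → x <? v q) ∩? (λ q → v q <? y)) N
    ∎
    where
    open ≡-Reasoning
    between : ∀ {z} → (z < y × ¬ z < suc x) ⇔ (x < z × z < y)
    between = mk⇔ (λ (z<y , z≮1+x) → ≰⇒> (z≮1+x ∘ s≤s) , z<y)
                  (λ (x<z , z<y) → z<y , <⇒≱ x<z ∘ ≤-pred)

  inversion-balance : ∀ {i} → i < N → i + rightInversions N v i ≡ v i + leftInversions v i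
  inversion-balance {i} i<N = begin
    i + R        ≡⟨ cong (_+ R) positions-split ⟩
    (D + L) + R  ≡⟨ xy∙z≈xz∙y D L R ⟩
    (D + R) + L  ≡⟨ cong (_+ L) values-split ⟨
    v i + L      ∎
    where
    open ≡-Reasoning
    smaller? = λ q → v q <? v i
    R = rightInversions N v i
    L = leftInversions v i
    D = count smaller? i

    positions-split : i ≡ D + L
    positions-split = begin
        i
      ≡⟨ count-U i ⟨
        count U? i
      ≡⟨ count-split U? smaller? i ⟩
        count (U? ∩? smaller?) i + count (U? ∩? ∁? smaller?) i
      ≡⟨ cong₂ _+_ (count-cong i λ _ _ → mk⇔ proj₂ (tt ,_))
                   (count-cong i λ _ q<i → mk⇔ (larger q<i ∘ proj₂) ((tt ,_) ∘ <⇒≯)) ⟩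
        D + L
      ∎
      where
      larger : ∀ {q} → q < i → ¬ v q < v i → v i < v q
      larger q<i vq≮vi = ≤∧≢⇒< (≮⇒≥ vq≮vi) (λ vi≡vq → <-irrefl (sym (injective vi≡vq)) q<i)

    values-split : v i ≡ D + R
    values-split = begin
        v i
      ≡⟨ count-below (v i) (<⇒≤ (<-bound i<N)) ⟨
        count smaller? N
      ≡⟨ count-split smaller? (_<? i) N ⟩
        count (smaller? ∩? (_<? i)) N + count (smaller? ∩? ∁? (_<? i)) N
      ≡⟨ cong₂ _+_ (trans (count-cong N λ _ _ → mk⇔ swap swap) (count-prefix smaller? (<⇒≤ i<N)))
                   (count-cong N λ _ _ → after) ⟩
        D + R
      ∎
      where
      after : ∀ {q} → (v q < v i × ¬ q < i) ⇔ (i < q × v q < v i)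
      after = mk⇔ (λ (vq<vi , q≮i) → ≤∧≢⇒< (≮⇒≥ q≮i) (λ i≡q → <-irrefl (cong v (sym i≡q)) vq<vi) , vq<vi)
                  (λ (i<q , vq<vi) → vq<vi , <⇒≯ i<q)

transpose : ∀ {N v v⁻¹ a} → IsPerm N v v⁻¹ → 1 ≤ a → suc a < N →
            IsPerm N (s a ∘ v) (v⁻¹ ∘ s a)
transpose {N} {v} {v⁻¹} {a} π 1≤a 1+a<N = record
  { inverseˡ    = λ x → trans (cong v⁻¹ (s-involutive a (v x))) (inverseˡ x)
  ; inverseʳ    = λ x → trans (cong (s a) (inverseʳ (s a x))) (s-involutive a x)
  ; fixes-≥     = λ x N≤x → trans (cong (s a) (fixes-≥ x N≤x)) (beyond N≤x)
  ; fixes-0     = trans (cong (s a) fixes-0) (s-other a (<⇒≢ 1≤a) 0≢1+n)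
  ; count-below = count-below′
  }
  where
  open IsPerm π
  beyond : ∀ {x} → N ≤ x → s a x ≡ x
  beyond N≤x = s-other a (>⇒≢ (<-≤-trans (<-trans (n<1+n a) 1+a<N) N≤x))
                         (>⇒≢ (<-≤-trans 1+a<N N≤x))

  -- Among the q with v q < a + 2, the condition v q < a + 1 fails only at v⁻¹ (a + 1),
  -- and s a (v q) < a + 1 fails only at v⁻¹ a.
  below-2+a : count (λ q → v q <? suc (suc a)) N ≡ suc (count (λ q → v q <? suc a) N)
  below-2+a = count-insert N (v⁻¹ (suc a)) (<-bound⁻¹ 1+a<N)
    (subst (λ y → ¬ y < suc a) (sym (inverseʳ (suc a))) (<-irrefl refl))
    (subst (_< suc (suc a)) (sym (inverseʳ (suc a))) (n<1+n (suc a)))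
    λ q _ q≢ → mk⇔ m<n⇒m<1+n λ vq<2+a →
      ≤∧≢⇒< (≤-pred vq<2+a) (q≢ ∘ v⁻¹-unique)

  swapped-below-2+a : count (λ q → v q <? suc (suc a)) N ≡ suc (count (λ q → s a (v q) <? suc a) N)
  swapped-below-2+a = count-insert N (v⁻¹ a) (<-bound⁻¹ (<-trans (n<1+n a) 1+a<N))
    (subst (λ y → ¬ s a y < suc a) (sym (inverseʳ a)) (subst (λ y → ¬ y < suc a) (sym (s-a a)) (<-irrefl refl)))
    (subst (_< suc (suc a)) (sym (inverseʳ a)) (<-trans (n<1+n a) (n<1+n (suc a))))
    λ q _ q≢ → swapped-⇔ (v q) (q≢ ∘ v⁻¹-unique)
    where
    swapped-⇔ : ∀ y → y ≢ a → s a y < suc a ⇔ y < suc (suc a)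
    swapped-⇔ y y≢a with swapView a y
    ... | at-a   = ⊥-elim (y≢a refl)
    ... | at-1+a rewrite s-1+a a = mk⇔ (λ _ → n<1+n (suc a)) (λ _ → n<1+n a)
    ... | other _ y≢1+a rewrite s-other a y≢a y≢1+a =
          mk⇔ m<n⇒m<1+n (λ y<2+a → ≤∧≢⇒< (≤-pred y<2+a) y≢1+a)

  count-below′ : ∀ k → k ≤ N → count (λ q → s a (v q) <? k) N ≡ k
  count-below′ k k≤N with k ≟ suc a
  ... | no k≢1+a = trans (count-cong N λ q _ → s-<-bound-⇔ a (v q) k≢1+a) (count-below k k≤N)
  ... | yes refl = suc-injective (begin
      suc (count (λ q → s a (v q) <? suc a) N) ≡⟨ sym swapped-below-2+a ⟩
      count (λ q → v q <? suc (suc a)) N       ≡⟨ below-2+a ⟩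
      suc (count (λ q → v q <? suc a) N)       ≡⟨ cong suc (count-below (suc a) (<⇒≤ 1+a<N)) ⟩
      suc (suc a)                              ∎)
    where open ≡-Reasoning

rightInversions-cong : ∀ N {v w} → (∀ x → v x ≡ w x) →
                       ∀ i → rightInversions N v i ≡ rightInversions N w i
rightInversions-cong N v≗w i = count-cong N λ q _ → ×-⇔ʳ λ _ →
  mk⇔ (subst₂ _<_ (v≗w q) (v≗w i)) (subst₂ _<_ (sym (v≗w q)) (sym (v≗w i)))

id-isPerm : ∀ N → IsPerm N id id
id-isPerm N = record
  { inverseˡ    = λ _ → refl
  ; inverseʳ    = λ _ → refl
  ; fixes-≥     = λ _ _ → refl
  ; fixes-0     = refl
  ; count-below = λ k k≤N → begin
      count (_<? k) N           ≡⟨ count-cong N (λ _ _ → mk⇔ (_, tt) proj₁) ⟩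
      count ((_<? k) ∩? U?) N   ≡⟨ count-prefix U? k≤N ⟩
      count U? k                ≡⟨ count-U k ⟩
      k                         ∎
  }
  where open ≡-Reasoning

rightInversions-id : ∀ N i → rightInversions N id i ≡ 0
rightInversions-id N i = count-stable {n = N} z≤n λ q _ _ (i<q , q<i) → <-asym i<q q<i

_HasHeights_ : Diagram → (ℕ → ℕ) → Set
T HasHeights h = ∀ i j → (i , j) ∈ T ⇔ j < h i

same-heights⇒≈D : ∀ {T T′ h h′} → T HasHeights h → T′ HasHeights h′ →
                  (∀ i → h i ≡ h′ i) → T ≈D T′
same-heights⇒≈D T-heights T′-heights h≗h′ (i , j) =
  Equivalence.from (T′-heights i j) ∘ subst (j <_) (h≗h′ i) ∘ Equivalence.to (T-heights i j) ,
  Equivalence.from (T-heights i j) ∘ subst (j <_) (sym (h≗h′ i)) ∘ Equivalence.to (T′-heights i j)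

module Sliding {N v v⁻¹} (π : IsPerm N v v⁻¹) {a} (1+a<N : suc a < N)
               {T} (T-heights : T HasHeights rightInversions N v) where

  open IsPerm π

  c : ℕ → ℕ
  c = rightInversions N v

  L : ℕ → ℕ
  L = leftInversions v

  p : ℕ
  p = v⁻¹ a

  a<N : a < N
  a<N = <-trans (n<1+n a) 1+a<N

  p<N : p < N
  p<N = <-bound⁻¹ a<N

  height-of : ∀ {i j} → (i , j) ∈ T → j < c i
  height-of = Equivalence.to (T-heights _ _)

  cell-of : ∀ {i j} → j < c i → (i , j) ∈ T
  cell-of = Equivalence.from (T-heights _ _)

  above : ℕ → ℕ
  above = count (λ q → a <? v q)

  -- The search P(γ, m) for the diagonal of a: γ has been raised once for every q < m
  -- with v q > a, and no such q carries the value a + 1.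
  record State (γ m : ℕ) : Set where
    field
      m≤p       : m ≤ p
      γ≡a+above : γ ≡ a + above m
      no-1+a    : ∀ q → q < m → v q ≢ suc a

  initial : 1 ≤ a → State a 1
  initial 1≤a = record
    { m≤p       = ≤∧≢⇒< z≤n λ 0≡p → <⇒≢ 1≤a (trans (sym fixes-0) (trans (cong v 0≡p) (inverseʳ a)))
    ; γ≡a+above = sym (trans (cong (a +_) above-1≡0) (+-identityʳ a))
    ; no-1+a    = λ { q (s≤s z≤n) → 0≢1+n ∘ trans (sym fixes-0) }
    }
    where
    above-1≡0 : above 1 ≡ 0
    above-1≡0 = count-stable {P? = λ q → a <? v q} z≤n
                  λ { q _ (s≤s z≤n) → n≮0 ∘ subst (a <_) fixes-0 }

  SmallOn : ℕ → ℕ → Set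
  SmallOn m i = ∀ q → m ≤ q → q < i → v q < a

  module _ {γ m i} (σ : State γ m) (m≤i : m ≤ i) (small : SmallOn m i) where
    open State σ

    i≤p : i ≤ p
    i≤p = ≮⇒≥ λ p<i → <-irrefl (inverseʳ a) (small p m≤p p<i)

    i<N : i < N
    i<N = ≤-<-trans i≤p p<N

    γ≡a+above-i : γ ≡ a + above i
    γ≡a+above-i = trans γ≡a+above
                        (cong (a +_) (sym (count-stable m≤i λ q m≤q q<i → <⇒≯ (small q m≤q q<i))))

    no-1+a-before : ∀ q → q < i → v q ≢ suc a
    no-1+a-before q q<i with q <? m
    ... | yes q<m = no-1+a q q<m
    ... | no  q≮m = <⇒≢ (m<n⇒m<1+n (small q (≮⇒≥ q≮m) q<i))

    on-diagonal : v i ≡ a → i + c i ≡ γ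
    on-diagonal vi≡a = begin
      i + c i      ≡⟨ inversion-balance i<N ⟩
      v i + L i    ≡⟨ cong₂ _+_ vi≡a (count-cong i λ q _ → mk⇔ (subst (_< v q) vi≡a)
                                                            (subst (_< v q) (sym vi≡a))) ⟩
      a + above i  ≡⟨ sym γ≡a+above-i ⟩
      γ            ∎
      where open ≡-Reasoning

    below-diagonal : v i < a → i + c i < γ
    below-diagonal vi<a = begin-strict
      i + c i                  ≡⟨ inversion-balance i<N ⟩
      v i + L i                ≡⟨ cong (v i +_) (count-split-⊆ i λ q a<vq → <-trans vi<a a<vq) ⟩
      v i + (above i + X)      ≤⟨ +-monoʳ-≤ (v i) (+-monoʳ-≤ (above i) X≤B) ⟩
      v i + (above i + B)      <⟨ n<1+n _ ⟩
      suc (v i + (above i + B)) ≡⟨ cong suc (x∙yz≈xz∙y (v i) (above i) B) ⟩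
      (suc (v i) + B) + above i ≡⟨ cong (_+ above i) (count-between vi<a (<⇒≤ a<N)) ⟨
      a + above i              ≡⟨ sym γ≡a+above-i ⟩
      γ                        ∎
      where
      open ≤-Reasoning
      X = count ((λ q → v i <? v q) ∩? ∁? (λ q → a <? v q)) i
      B = count ((λ q → v i <? v q) ∩? (λ q → v q <? a)) N
      X≤B : X ≤ B
      X≤B = ≤-trans (count-mono i λ q q<i (vi<vq , a≮vq) →
                       vi<vq , ≤∧≢⇒< (≮⇒≥ a≮vq) (<⇒≢ (<-≤-trans q<i i≤p) ∘ v⁻¹-unique))
                    (count-mono-bound (<⇒≤ i<N))

    module _ (a<vi : a < v i) where
      private
        X = count ((λ q → a <? v q) ∩? ∁? (λ q → v i <? v q)) i
        B = count ((λ q → a <? v q) ∩? (λ q → v q <? v i)) N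

        X≤B : X ≤ B
        X≤B = ≤-trans (count-mono i λ q q<i (a<vq , vi≮vq) →
                         a<vq , ≤∧≢⇒< (≮⇒≥ vi≮vq) (<⇒≢ q<i ∘ injective))
                      (count-mono-bound (<⇒≤ i<N))

        vi≡ : v i ≡ suc a + B
        vi≡ = count-between a<vi (<⇒≤ (<-bound i<N))

        γ≡ : γ ≡ a + (L i + X)
        γ≡ = trans γ≡a+above-i (cong (a +_) (count-split-⊆ i λ q vi<vq → <-trans a<vi vi<vq))

        diagonal≡ : i + c i ≡ suc (a + (L i + B))
        diagonal≡ = trans (inversion-balance i<N)
                          (trans (cong (_+ L i) vi≡) (cong suc (sym (x∙yz≈xz∙y a (L i) B))))

      above-diagonal : γ < i + c i
      above-diagonal = begin-strict
        γ                   ≡⟨ γ≡ ⟩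
        a + (L i + X)       ≤⟨ +-monoʳ-≤ a (+-monoʳ-≤ (L i) X≤B) ⟩
        a + (L i + B)       <⟨ n<1+n _ ⟩
        suc (a + (L i + B)) ≡⟨ sym diagonal≡ ⟩
        i + c i             ∎
        where open ≤-Reasoning

      next-diagonal : v i ≡ suc a → i + c i ≡ suc γ
      next-diagonal vi≡1+a = begin
        i + c i             ≡⟨ diagonal≡ ⟩
        suc (a + (L i + B)) ≡⟨ cong (λ b → suc (a + (L i + b))) (trans B≡0 (sym X≡0)) ⟩
        suc (a + (L i + X)) ≡⟨ cong suc γ≡ ⟨
        suc γ               ∎
        where
        open ≡-Reasoning
        B≡0 : B ≡ 0
        B≡0 = +-cancelˡ-≡ (suc a) B 0 (trans (sym vi≡) (trans vi≡1+a (sym (+-identityʳ (suc a)))))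
        X≡0 : X ≡ 0
        X≡0 = n≤0⇒n≡0 (subst (X ≤_) B≡0 X≤B)

      advance : v i ≢ suc a → State (suc γ) (suc i)
      advance vi≢1+a = record
        { m≤p       = ≤∧≢⇒< i≤p λ i≡p → <-irrefl (sym (trans (cong v i≡p) (inverseʳ a))) a<vi
        ; γ≡a+above = trans (cong suc γ≡a+above-i)
                            (trans (sym (+-suc a (above i))) (cong (a +_) (sym (count-suc i a<vi))))
        ; no-1+a    = λ q q<1+i →
                        [ no-1+a-before q , (λ { refl → vi≢1+a }) ]′ (m≤n⇒m<n∨m≡n (≤-pred q<1+i))
        }

  lands : ∀ {γ m i} → State γ m → m ≤ i → SmallOn m i → i + c i ≡ γ → i ≡ p
  lands {i = i} σ m≤i small on with <-cmp (v i) a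
  ... | tri< vi<a _ _ = ⊥-elim (<-irrefl on (below-diagonal σ m≤i small vi<a))
  ... | tri≈ _ vi≡a _ = v⁻¹-unique vi≡a
  ... | tri> _ _ a<vi = ⊥-elim (<-irrefl (sym on) (above-diagonal σ m≤i small a<vi))

  passes : ∀ {γ m i} → State γ m → m ≤ i → SmallOn m i →
           suc (suc γ) ≤ i + c i → State (suc γ) (suc i)
  passes {γ} {i = i} σ m≤i small beyond with <-cmp (v i) a
  ... | tri< vi<a _ _ = ⊥-elim (<⇒≱ (below-diagonal σ m≤i small vi<a) (≤-trans (m≤n+m γ 2) beyond))
  ... | tri≈ _ vi≡a _ = ⊥-elim (<⇒≱ beyond (≤-trans (≤-reflexive (on-diagonal σ m≤i small vi≡a)) (n≤1+n γ)))
  ... | tri> _ _ a<vi with v i ≟ suc a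
  ...   | yes vi≡1+a = ⊥-elim (<⇒≱ beyond (≤-reflexive (next-diagonal σ m≤i small a<vi vi≡1+a)))
  ...   | no  vi≢1+a = advance σ m≤i small a<vi vi≢1+a

  under-diagonal⇒small : ∀ {γ m i} → State γ m → m ≤ i → SmallOn m i → i + c i < γ → v i < a
  under-diagonal⇒small {i = i} σ m≤i small under with <-cmp (v i) a
  ... | tri< vi<a _ _ = vi<a
  ... | tri≈ _ vi≡a _ = ⊥-elim (<-irrefl (on-diagonal σ m≤i small vi≡a) under)
  ... | tri> _ _ a<vi = ⊥-elim (<-asym (above-diagonal σ m≤i small a<vi) under)

  small-until : ∀ {γ m} → State γ m → ∀ i → (∀ q → m ≤ q → q < i → q + c q < γ) → SmallOn m i
  small-until σ (suc i) under q m≤q q<1+i =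
    [ small q m≤q , (λ { refl → under-diagonal⇒small σ m≤q small (under q m≤q ≤-refl) }) ]′
      (m≤n⇒m<n∨m≡n (≤-pred q<1+i))
    where small = small-until σ i λ q′ m≤q′ q′<i → under q′ m≤q′ (m<n⇒m<1+n q′<i)

  start≤γ : ∀ {γ m} → State γ m → m ≤ γ
  start≤γ {γ} {m} σ = begin
      m
    ≡⟨ count-U m ⟨
      count U? m
    ≡⟨ count-split-⊆ m _ ⟩
      count (λ q → v q <? a) m + count (U? ∩? ∁? (λ q → v q <? a)) m
    ≤⟨ +-monoˡ-≤ _ (count-mono-bound (<⇒≤ (≤-<-trans m≤p p<N))) ⟩
      count (λ q → v q <? a) N + count (U? ∩? ∁? (λ q → v q <? a)) m
    ≡⟨ cong₂ _+_ (count-below a (<⇒≤ a<N)) (count-cong m λ _ q<m → not-small q<m) ⟩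
      a + above m
    ≡⟨ γ≡a+above ⟨
      γ
    ∎
    where
    open ≤-Reasoning
    open State σ
    not-small : ∀ {q} → q < m → (⊤ × ¬ v q < a) ⇔ a < v q
    not-small q<m = mk⇔ (λ (_ , vq≮a) → ≤∧≢⇒< (≮⇒≥ vq≮a) (<⇒≢ (<-≤-trans q<m m≤p) ∘ v⁻¹-unique ∘ sym))
                        (λ a<vq → tt , <⇒≯ a<vq)

  off-diagonal : ∀ {γ q} → q < γ → (∀ j → q + j + 1 ≡ γ → (q , j) ∉ T) → q + c q < γ
  off-diagonal {γ} {q} q<γ no-cell with q + c q <? γ
  ... | yes below = below
  ... | no  q+cq≮γ = ⊥-elim (no-cell j (trans (+-comm (q + j) 1) q+1+j≡γ) (cell-of j<cq))
    where
    j = proj₁ (m≤n⇒∃[o]m+o≡n q<γ)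
    q+1+j≡γ : suc (q + j) ≡ γ
    q+1+j≡γ = proj₂ (m≤n⇒∃[o]m+o≡n q<γ)
    j<cq : j < c q
    j<cq = +-cancelˡ-≤ q (suc j) (c q)
             (subst (_≤ q + c q) (trans (sym q+1+j≡γ) (sym (+-suc q j))) (≮⇒≥ q+cq≮γ))

  diagonal-+1 : ∀ {γ i j} → i + j + 1 ≡ γ → i + suc j ≡ γ
  diagonal-+1 {i = i} {j} on = trans (+-suc i j) (trans (+-comm 1 (i + j)) on)

  small-before-γ : ∀ {γ m} → State γ m → NoDiag T γ m → SmallOn m γ
  small-before-γ σ empty = small-until σ _ λ q m≤q q<γ → off-diagonal q<γ λ j → empty q j m≤q

  small-before-first : ∀ {γ m i j} → State γ m → FirstOnDiag T γ m i j → SmallOn m i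
  small-before-first {i = i} {j} σ (_ , on , _ , first) =
    small-until σ i λ q m≤q q<i → off-diagonal (<-trans q<i i<γ) λ j′ → first q j′ m≤q q<i
    where
    i<γ = subst (i <_) (diagonal-+1 on) (m<m+n i z<s)

  ascent : ∀ {γ m} → State γ m → SmallOn m p → p < v⁻¹ (suc a)
  ascent σ small = ≰⇒> λ p′≤p → not-1+a p′≤p (inverseʳ (suc a))
    where
    not-1+a : ∀ {q} → q ≤ p → v q ≢ suc a
    not-1+a q≤p with m≤n⇒m<n∨m≡n q≤p
    ... | inj₁ q<p  = no-1+a-before σ (State.m≤p σ) small _ q<p
    ... | inj₂ refl = λ vp≡1+a → 1+n≢n (trans (sym vp≡1+a) (inverseʳ a))

  settle : ∀ {γ m i k} → State γ m → m ≤ i → SmallOn m i → k ≡ c i → i + k ≡ γ →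
           (i , k) ∷ T ≡ (p , c p) ∷ T × p < v⁻¹ (suc a)
  settle σ m≤i small refl on with lands σ m≤i small on
  ... | refl = refl , ascent σ small

  two-beyond : ∀ {γ i d} → i + d ≡ γ → suc d < c i → suc (suc γ) ≤ i + c i
  two-beyond {i = i} {d} refl 1+d<ci =
    subst (_≤ i + c i) (trans (+-suc i (suc d)) (cong suc (+-suc i d))) (+-monoʳ-≤ i 1+d<ci)

  slide : ∀ {γ m R} → State γ m → Slide T γ m R → R ≡ (p , c p) ∷ T × p < v⁻¹ (suc a)
  slide {γ} σ (s1a empty γ0∉T) =
    settle σ (start≤γ σ) (small-before-γ σ empty)
           (sym (n≤0⇒n≡0 (≮⇒≥ (γ0∉T ∘ cell-of)))) (+-identityʳ γ)
  slide {γ} σ (s1c empty _ γ1∈T rest) =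
    slide (passes σ (start≤γ σ) (small-before-γ σ empty) (two-beyond (+-identityʳ γ) (height-of γ1∈T))) rest
  slide σ (s2a first@(m≤i , on , ij∈T , _) i1+j∉T) =
    settle σ m≤i (small-before-first σ first)
           (≤-antisym (height-of ij∈T) (≮⇒≥ (i1+j∉T ∘ cell-of))) (diagonal-+1 on)
  slide σ (s2c first@(m≤i , on , _ , _) _ i2+j∈T rest) =
    slide (passes σ m≤i (small-before-first σ first) (two-beyond (diagonal-+1 on) (height-of i2+j∈T))) rest

  module _ (p<p′ : p < v⁻¹ (suc a)) where
    private
      c′ : ℕ → ℕ
      c′ = rightInversions N (s a ∘ v)

      p′ = v⁻¹ (suc a)

      -- s a ∘ v has one inversion more than v, namely (p , p′).
      c′p≡ : c′ p ≡ suc (c p)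
      c′p≡ = count-insert N p′ (<-bound⁻¹ 1+a<N)
        (λ (_ , vp′<vp) → <-asym vp′<vp (subst₂ _<_ (sym (inverseʳ a)) (sym (inverseʳ (suc a))) (n<1+n a)))
        (p<p′ , subst₂ _<_ (sym (trans (cong (s a) (inverseʳ (suc a))) (s-1+a a)))
                           (sym (trans (cong (s a) (inverseʳ a)) (s-a a))) (n<1+n a))
        λ q _ q≢p′ → ×-⇔ʳ λ p<q → ⇔-sym (s-<-⇔ a (¬a-1+a p<q) (¬1+a-a q≢p′))
        where
        ¬a-1+a : ∀ {q} → p < q → ¬ (v q ≡ a × v p ≡ suc a)
        ¬a-1+a p<q (vq≡a , _) = <⇒≢ p<q (sym (v⁻¹-unique vq≡a))
        ¬1+a-a : ∀ {q} → q ≢ p′ → ¬ (v q ≡ suc a × v p ≡ a)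
        ¬1+a-a q≢p′ (vq≡1+a , _) = q≢p′ (v⁻¹-unique vq≡1+a)

      c′i≡ : ∀ {i} → i ≢ p → c′ i ≡ c i
      c′i≡ {i} i≢p = count-cong N λ q _ → ×-⇔ʳ λ i<q → s-<-⇔ a (¬a-1+a i<q) ¬1+a-a
        where
        ¬a-1+a : ∀ {q} → i < q → ¬ (v q ≡ a × v i ≡ suc a)
        ¬a-1+a i<q (vq≡a , vi≡1+a) = <-asym p<p′ (subst₂ _<_ (v⁻¹-unique vi≡1+a) (v⁻¹-unique vq≡a) i<q)
        ¬1+a-a : ∀ {q} → ¬ (v q ≡ suc a × v i ≡ a)
        ¬1+a-a (_ , vi≡a) = i≢p (v⁻¹-unique vi≡a)

    heights-after : ((p , c p) ∷ T) HasHeights rightInversions N (s a ∘ v)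
    heights-after i j = mk⇔ to from
      where
      to : (i , j) ∈ (p , c p) ∷ T → j < c′ i
      to (here refl) = subst (c p <_) (sym c′p≡) (n<1+n (c p))
      to (there ij∈T) with i ≟ p
      ... | yes refl = subst (j <_) (sym c′p≡) (m<n⇒m<1+n (height-of ij∈T))
      ... | no  i≢p  = subst (j <_) (sym (c′i≡ i≢p)) (height-of ij∈T)
      from : j < c′ i → (i , j) ∈ (p , c p) ∷ T
      from j<c′i with i ≟ p
      ... | no  i≢p  = there (cell-of (subst (j <_) (c′i≡ i≢p) j<c′i))
      ... | yes refl with m≤n⇒m<n∨m≡n (≤-pred (subst (j <_) c′p≡ j<c′i))
      ...   | inj₁ j<cp = there (cell-of j<cp)
      ...   | inj₂ refl = here refl

  slideInto-heights : ∀ {R} → 1 ≤ a → SlideInto a T R → R HasHeights rightInversions N (s a ∘ v)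
  slideInto-heights 1≤a slid with slide (initial 1≤a) slid
  ... | refl , p<p′ = heights-after p<p′

transposeAll : List ℕ → (ℕ → ℕ) → ℕ → ℕ
transposeAll []      v = v
transposeAll (a ∷ w) v = transposeAll w (s a ∘ v)

sprod-transposeAll : ∀ w v x → sprod w (transposeAll w v x) ≡ v x
sprod-transposeAll []      v x = refl
sprod-transposeAll (a ∷ w) v x =
  trans (cong (s a) (sprod-transposeAll w (s a ∘ v) x)) (s-involutive a (v x))

sprod-injective : ∀ w {x y} → sprod w x ≡ sprod w y → x ≡ y
sprod-injective []      e = e
sprod-injective (a ∷ w) e = sprod-injective w (s-injective a e)

transposeAll-unique : ∀ α β → (∀ x → sprod α x ≡ sprod β x) →
                      ∀ x → transposeAll α id x ≡ transposeAll β id x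
transposeAll-unique α β same x = sprod-injective α (begin
  sprod α (transposeAll α id x) ≡⟨ sprod-transposeAll α id x ⟩
  x                             ≡⟨ sprod-transposeAll β id x ⟨
  sprod β (transposeAll β id x) ≡⟨ same _ ⟨
  sprod α (transposeAll β id x) ∎)
  where open ≡-Reasoning

insertAll : ∀ {N v v⁻¹ T w R} → IsPerm N v v⁻¹ → T HasHeights rightInversions N v →
            All (λ a → 1 ≤ a × suc a < N) w → Run T w R →
            R HasHeights rightInversions N (transposeAll w v)
insertAll π T-heights []                         done            = T-heights
insertAll π T-heights ((1≤a , 1+a<N) ∷ letters) (step slid run) =
  insertAll (transpose π 1≤a 1+a<N) (Sliding.slideInto-heights π 1+a<N T-heights 1≤a slid) letters run

letters-bounded : ∀ {w K} → All (1 ≤_) w → sum w ≤ K → All (λ a → 1 ≤ a × suc a < 2 + K) w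
letters-bounded []                  _     = []
letters-bounded {a ∷ w} (1≤a ∷ 1≤w) a+w≤K =
  (1≤a , s≤s (s≤s (≤-trans (m≤m+n a (sum w)) a+w≤K)))
  ∷ letters-bounded 1≤w (≤-trans (m≤n+m (sum w) a) a+w≤K)

shape-heights : ∀ {N w S} → All (λ a → 1 ≤ a × suc a < N) w → SRShape w S →
                S HasHeights rightInversions N (transposeAll w id)
shape-heights {N} letters run = insertAll (id-isPerm N) empty letters run
  where
  empty : [] HasHeights rightInversions N id
  empty i j = mk⇔ (λ ()) (λ j<0 → ⊥-elim (n≮0 (subst (j <_) (rightInversions-id N i) j<0)))

theorem4p1 : (n : ℕ) (α β : List ℕ) →
    length α ≡ n → length β ≡ n →
    All (1 ≤_) α → All (1 ≤_) β →
    (Sα Sβ : Diagram) → SRShape α Sα → SRShape β Sβ →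
    (∀ x → sprod α x ≡ sprod β x) →
    Sα ≈D Sβ
theorem4p1 _ α β _ _ 1≤α 1≤β _ _ runα runβ same-product =
  same-heights⇒≈D (shape-heights (letters-bounded 1≤α (m≤m+n (sum α) (sum β))) runα)
                  (shape-heights (letters-bounded 1≤β (m≤n+m (sum β) (sum α))) runβ)
                  (rightInversions-cong (2 + (sum α + sum β)) (transposeAll-unique α β same-product))
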